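{- Let $\Gamma$ be an $l$-context and $\Delta$ an $r$-context of $\overline{\lambda}\mu\tilde{\mu}^*$. (1) If $\Gamma\rhd t:A\mid\Delta$, then $\Gamma^{\mathfrak e},(\Delta^{\mathfrak e})^\bot\vdash t^{\mathfrak e}:A^{\mathfrak e}$. (2) If $\Gamma\mid e:A\rhd\Delta$, then $\Gamma^{\mathfrak e},(\Delta^{\mathfrak e})^\bot\vdash e^{\mathfrak e}:(A^{\mathfrak e})^\bot$. (3) If $p:(\Gamma\rhd\Delta)$, then $\Gamma^{\mathfrak e},(\Delta^{\mathfrak e})^\bot\vdash p^{\mathfrak e}:\bot$.
   Context: $\overline{\lambda}\mu\tilde{\mu}^*$: $l$-variables $x,y,\dots$, $r$-variables $\alpha,\beta,\dots$; $p::=\lfloor t,e\rfloor$; $t::=x\mid\lambda x\,t\mid\mu\alpha\,p\mid\overline{e}$; $e::=\alpha\mid(t.e)\mid\tilde{\mu}x\,p\mid\widetilde{t}$. Types: atomic types, $A\to B$, $A^\bot$, modulo $(A^\bot)^\bot=A$. Typing: $\Gamma,x:A\rhd x:A\mid\Delta$; $\Gamma\mid\alpha:A\rhd\alpha:A,\Delta$; $\lambda x\,t:A\to B$ from $\Gamma,x:A\rhd t:B\mid\Delta$; $(t.e):A\to B$ from $t:A$ and $e:B$; $\lfloor t,e\rfloor:(\Gamma\rhd\Delta)$ from $\Gamma\rhd t:A\mid\Delta$ and $\Gamma\mid e:A\rhd\Delta$; $\Gamma\rhd\mu\alpha\,p:A\mid\Delta$ from $p:(\Gamma\rhd\alpha:A,\Delta)$;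 $\Gamma\mid\tilde\mu x\,p:A\rhd\Delta$ from $p:(\Gamma,x:A\rhd\Delta)$; $\overline{e}:A^\bot$ from $e:A$; $\widetilde t:A^\bot$ from $t:A$. $\lambda^{Sym}_{Prop}$ (same atomic types): m-types $A::=\alpha\mid\alpha^\bot\mid A\wedge A\mid A\vee A$, types m-types or $\bot$, involutive negation $(\alpha)^\bot=\alpha^\bot$, $(\alpha^\bot)^\bot=\alpha$, $(A\wedge B)^\bot=A^\bot\vee B^\bot$, $(A\vee B)^\bot=A^\bot\wedge B^\bot$; typing $\Gamma,x:A\vdash x:A$; $\langle P_1,P_2\rangle:A_1\wedge A_2$; $\sigma_i(P_i):A_1\vee A_2$; $\lambda xP:A^\bot$ from $\Gamma,x:A\vdash P:\bot$; $(P_1\star P_2):\bot$ from $P_1:A^\bot,P_2:A$. Translation $\cdot^{\mathfrak e}$: each $r$-variable $\alpha$ has an associated $\lambda^{Sym}_{Prop}$ variable $\overline{\alpha}$ (distinct from all others). Write $\pi_i(y)=\lambda z(y\star\sigma_i(z))$. Then $\lfloor v,u\rfloor^{\mathfrak e}=(u^{\mathfrak e}\star v^{\mathfrak e})$; $x^{\mathfrak e}=x$; $(\lambda x\,u)^{\mathfrak e}=\lambda y(\lambda x(\pi_2(y)\star u^{\mathfrak e})\star\pi_1(y))$ ($y,z$ fresh); $(\mu\alpha\,p)^{\mathfrak e}=\lambda\overline{\alpha}\,p^{\mathfrak e}$; $(\overline{h})^{\mathfrak e}=h^{\mathfrak e}$; $\alpha^{\mathfrak e}=\overline{\alpha}$;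 $(t.h)^{\mathfrak e}=\langle t^{\mathfrak e},h^{\mathfrak e}\rangle$; $(\tilde\mu x\,p)^{\mathfrak e}=\lambda x\,p^{\mathfrak e}$; $(\widetilde{u})^{\mathfrak e}=u^{\mathfrak e}$. On types: $A^{\mathfrak e}=A$ for atomic $A$, $(A^\bot)^{\mathfrak e}=(A^{\mathfrak e})^\bot$, $(A\to B)^{\mathfrak e}=(A^{\mathfrak e})^\bot\vee B^{\mathfrak e}$. $\Gamma^{\mathfrak e}=\{x:A^{\mathfrak e}\mid x:A\in\Gamma\}$ and $(\Delta^{\mathfrak e})^\bot=\{\overline{\alpha}:(A^{\mathfrak e})^\bot\mid\alpha:A\in\Delta\}$. -}

module Defs where

open import Data.Nat using (ℕ)
open import Data.List using (List; []; _∷_; map; _++_)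
open import Data.Product using (_×_; _,_)
open import Relation.Binary.PropositionalEquality using (_≡_; _≢_)

-- Contexts: lists of declarations, most recent first; lookup finds the
-- most recent declaration of a variable (later declarations shadow).

data _∋_∶_ {K V : Set} : List (K × V) → K → V → Set where
  here  : ∀ {Γ x A} → ((x , A) ∷ Γ) ∋ x ∶ A
  there : ∀ {Γ x y A B} → x ≢ y → Γ ∋ x ∶ A → ((y , B) ∷ Γ) ∋ x ∶ A

-- λ̄μμ̃* : types modulo (A^⊥)^⊥ = A, represented in canonical form:
-- a type is a "positive" type P (atomic or arrow) or its orthogonal P^⊥.

mutual
  data PTy : Set where
    atom : ℕ → PTy
    _⇒_  : Ty → Ty → PTy

  data Ty : Set where
    pos : PTy → Ty
    neg : PTy → Ty

_ᗮ : Ty → Ty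
pos P ᗮ = neg P
neg P ᗮ = pos P

mutual
  data Cmd : Set where
    ⌊_,_⌋ : Tm → CTm → Cmd

  data Tm : Set where
    var : ℕ → Tm
    lam : ℕ → Tm → Tm
    mu  : ℕ → Cmd → Tm
    bar : CTm → Tm

  data CTm : Set where
    covar : ℕ → CTm
    _·_   : Tm → CTm → CTm
    mut   : ℕ → Cmd → CTm
    tilde : Tm → CTm

LCtx : Set
LCtx = List (ℕ × Ty)

RCtx : Set
RCtx = List (ℕ × Ty)

infix 4 _▷_∶_∣_ _∣_∶_▷_ _∶⟨_▷_⟩

mutual
  data _▷_∶_∣_ : LCtx → Tm → Ty → RCtx → Set where
    ax  : ∀ {Γ Δ x A} → Γ ∋ x ∶ A → Γ ▷ var x ∶ A ∣ Δ
    lam : ∀ {Γ Δ x t A B} → ((x , A) ∷ Γ) ▷ t ∶ B ∣ Δ →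
          Γ ▷ lam x t ∶ pos (A ⇒ B) ∣ Δ
    mu  : ∀ {Γ Δ α p A} → p ∶⟨ Γ ▷ ((α , A) ∷ Δ) ⟩ → Γ ▷ mu α p ∶ A ∣ Δ
    bar : ∀ {Γ Δ e A} → Γ ∣ e ∶ A ▷ Δ → Γ ▷ bar e ∶ A ᗮ ∣ Δ

  data _∣_∶_▷_ : LCtx → CTm → Ty → RCtx → Set where
    ax    : ∀ {Γ Δ α A} → Δ ∋ α ∶ A → Γ ∣ covar α ∶ A ▷ Δ
    app   : ∀ {Γ Δ t e A B} → Γ ▷ t ∶ A ∣ Δ → Γ ∣ e ∶ B ▷ Δ →
            Γ ∣ t · e ∶ pos (A ⇒ B) ▷ Δ
    mut   : ∀ {Γ Δ x p A} → p ∶⟨ ((x , A) ∷ Γ) ▷ Δ ⟩ → Γ ∣ mut x p ∶ A ▷ Δ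
    tilde : ∀ {Γ Δ t A} → Γ ▷ t ∶ A ∣ Δ → Γ ∣ tilde t ∶ A ᗮ ▷ Δ

  data _∶⟨_▷_⟩ : Cmd → LCtx → RCtx → Set where
    cut : ∀ {Γ Δ t e A} → Γ ▷ t ∶ A ∣ Δ → Γ ∣ e ∶ A ▷ Δ →
          ⌊ t , e ⌋ ∶⟨ Γ ▷ Δ ⟩

data MTy : Set where
  at  : ℕ → MTy
  atᗮ : ℕ → MTy
  _∧_ : MTy → MTy → MTy
  _∨_ : MTy → MTy → MTy

_ᵐᗮ : MTy → MTy
at a ᵐᗮ    = atᗮ a
atᗮ a ᵐᗮ   = at a
(A ∧ B) ᵐᗮ = (A ᵐᗮ) ∨ (B ᵐᗮ)
(A ∨ B) ᵐᗮ = (A ᵐᗮ) ∧ (B ᵐᗮ)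

data STy : Set where
  ty : MTy → STy
  ⊥ₛ : STy

-- variables of λ^Sym_Prop: images of l-variables (lv x), the variables
-- ᾱ associated with r-variables (rv α), and the two bound variables y, z
-- used by the translation (distinct from all lv/rv variables).
data SVar : Set where
  lv : ℕ → SVar
  rv : ℕ → SVar
  yv : SVar
  zv : SVar

data STm : Set where
  var  : SVar → STm
  ⟨_,_⟩ : STm → STm → STm
  σ₁   : STm → STm
  σ₂   : STm → STm
  lam  : SVar → STm → STm
  _⋆_  : STm → STm → STm

SCtx : Set
SCtx = List (SVar × MTy)

infix 4 _⊢_∶_

data _⊢_∶_ : SCtx → STm → STy → Set where
  ax   : ∀ {Γ x A} → Γ ∋ x ∶ A → Γ ⊢ var x ∶ ty A
  pair : ∀ {Γ P₁ P₂ A₁ A₂} → Γ ⊢ P₁ ∶ ty A₁ → Γ ⊢ P₂ ∶ ty A₂ →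
         Γ ⊢ ⟨ P₁ , P₂ ⟩ ∶ ty (A₁ ∧ A₂)
  inl  : ∀ {Γ P A₁ A₂} → Γ ⊢ P ∶ ty A₁ → Γ ⊢ σ₁ P ∶ ty (A₁ ∨ A₂)
  inr  : ∀ {Γ P A₁ A₂} → Γ ⊢ P ∶ ty A₂ → Γ ⊢ σ₂ P ∶ ty (A₁ ∨ A₂)
  abs  : ∀ {Γ x P A} → ((x , A) ∷ Γ) ⊢ P ∶ ⊥ₛ → Γ ⊢ lam x P ∶ ty (A ᵐᗮ)
  cut  : ∀ {Γ P₁ P₂ A} → Γ ⊢ P₁ ∶ ty (A ᵐᗮ) → Γ ⊢ P₂ ∶ ty A →
         Γ ⊢ P₁ ⋆ P₂ ∶ ⊥ₛ

mutual
  ePTy : PTy → MTy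
  ePTy (atom a) = at a
  ePTy (A ⇒ B)  = (eTy A ᵐᗮ) ∨ eTy B

  eTy : Ty → MTy
  eTy (pos P) = ePTy P
  eTy (neg P) = ePTy P ᵐᗮ

π₁ π₂ : SVar → STm
π₁ y = lam zv (var y ⋆ σ₁ (var zv))
π₂ y = lam zv (var y ⋆ σ₂ (var zv))

mutual
  eCmd : Cmd → STm
  eCmd ⌊ v , u ⌋ = eCTm u ⋆ eTm v

  eTm : Tm → STm
  eTm (var x)   = var (lv x)
  eTm (lam x u) = lam yv (lam (lv x) (π₂ yv ⋆ eTm u) ⋆ π₁ yv)
  eTm (mu α p)  = lam (rv α) (eCmd p)
  eTm (bar h)   = eCTm h

  eCTm : CTm → STm
  eCTm (covar α) = var (rv α)
  eCTm (t · h)   = ⟨ eTm t , eCTm h ⟩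
  eCTm (mut x p) = lam (lv x) (eCmd p)
  eCTm (tilde u) = eTm u

eL : LCtx → SCtx
eL = map (λ { (x , A) → (lv x , eTy A) })

eRᗮ : RCtx → SCtx
eRᗮ = map (λ { (α , A) → (rv α , eTy A ᵐᗮ) })

-- Most
-- cases are a single λ^Sym_Prop rule followed by a type conversion that
-- uses the involutivity of negation on m-types.
-- The μ-case uses exchange (ᾱ is bound in front of the context rather than
-- at the head of the r-part) and the λ-case uses weakening by y.
module Submission where

open import Defs
open import Data.List using (List; []; _∷_; _++_)
open import Data.List.Relation.Unary.All using (All; []; _∷_)
open import Data.List.Relation.Unary.All.Properties using (++⁺)
open import Data.Product using (_×_; _,_; proj₁)
open import Relation.Binary.PropositionalEquality
  using (_≡_; _≢_; refl; sym; trans; cong; cong₂; subst)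

ᵐᗮ-involutive : ∀ A → (A ᵐᗮ) ᵐᗮ ≡ A
ᵐᗮ-involutive (at a)  = refl
ᵐᗮ-involutive (atᗮ a) = refl
ᵐᗮ-involutive (A ∧ B) = cong₂ _∧_ (ᵐᗮ-involutive A) (ᵐᗮ-involutive B)
ᵐᗮ-involutive (A ∨ B) = cong₂ _∨_ (ᵐᗮ-involutive A) (ᵐᗮ-involutive B)

eTy-ᗮ : ∀ A → eTy (A ᗮ) ≡ eTy A ᵐᗮ
eTy-ᗮ (pos P) = refl
eTy-ᗮ (neg P) = sym (ᵐᗮ-involutive (ePTy P))

retype : ∀ {Γ P A B} → A ≡ B → Γ ⊢ P ∶ ty A → Γ ⊢ P ∶ ty B
retype {Γ} {P} = subst (λ C → Γ ⊢ P ∶ ty C)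

Ren : SCtx → SCtx → Set
Ren Γ Γ′ = ∀ {v A} → Γ ∋ v ∶ A → Γ′ ∋ v ∶ A

lift : ∀ {Γ Γ′ v A} → Ren Γ Γ′ → Ren ((v , A) ∷ Γ) ((v , A) ∷ Γ′)
lift ρ here         = here
lift ρ (there ne p) = there ne (ρ p)

rename : ∀ {Γ Γ′ P T} → Ren Γ Γ′ → Γ ⊢ P ∶ T → Γ′ ⊢ P ∶ T
rename ρ (ax p)     = ax (ρ p)
rename ρ (pair d e) = pair (rename ρ d) (rename ρ e)
rename ρ (inl d)    = inl (rename ρ d)
rename ρ (inr d)    = inr (rename ρ d)
rename ρ (abs d)    = abs (rename (lift ρ) d)
rename ρ (cut d e)  = cut (rename ρ d) (rename ρ e)

Fresh : {K V : Set} → K → List (K × V) → Set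
Fresh v = All (λ d → v ≢ proj₁ d)

fresh-lookup : ∀ {K V : Set} {Γ : List (K × V)} {v w A} →
               Fresh v Γ → Γ ∋ w ∶ A → w ≢ v
fresh-lookup (v≢w ∷ _) here         w≡v = v≢w (sym w≡v)
fresh-lookup (_ ∷ fr)  (there _ p)  = fresh-lookup fr p

weaken-fresh : ∀ {Γ v T} → Fresh v Γ → Ren Γ ((v , T) ∷ Γ)
weaken-fresh fr p = there (fresh-lookup fr p) p

exchange : ∀ {Γ₁ R v T} → Fresh v Γ₁ → Ren (Γ₁ ++ (v , T) ∷ R) ((v , T) ∷ Γ₁ ++ R)
exchange []        p            = p
exchange (v≢w ∷ _) here         = there (λ w≡v → v≢w (sym w≡v)) here
exchange (_ ∷ fr)  (there ne p) with exchange fr p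
... | here         = here
... | there ne′ q  = there ne′ (there ne q)

∋-++ˡ : ∀ {K V : Set} {Γ₁ Γ₂ : List (K × V)} {v A} → Γ₁ ∋ v ∶ A → (Γ₁ ++ Γ₂) ∋ v ∶ A
∋-++ˡ here         = here
∋-++ˡ (there ne p) = there ne (∋-++ˡ p)

∋-++ʳ : ∀ {K V : Set} {Γ₁ Γ₂ : List (K × V)} {v A} →
        Fresh v Γ₁ → Γ₂ ∋ v ∶ A → (Γ₁ ++ Γ₂) ∋ v ∶ A
∋-++ʳ []         p = p
∋-++ʳ (v≢w ∷ fr) p = there v≢w (∋-++ʳ fr p)

lv-injective : ∀ {x y} → lv x ≡ lv y → x ≡ y
lv-injective refl = refl

rv-injective : ∀ {α β} → rv α ≡ rv β → α ≡ β
rv-injective refl = refl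

lookup-eL : ∀ {Γ x A} → Γ ∋ x ∶ A → eL Γ ∋ lv x ∶ eTy A
lookup-eL here         = here
lookup-eL (there ne p) = there (λ e → ne (lv-injective e)) (lookup-eL p)

lookup-eRᗮ : ∀ {Δ α A} → Δ ∋ α ∶ A → eRᗮ Δ ∋ rv α ∶ (eTy A ᵐᗮ)
lookup-eRᗮ here         = here
lookup-eRᗮ (there ne p) = there (λ e → ne (rv-injective e)) (lookup-eRᗮ p)

eL-fresh : ∀ {v} → (∀ x → v ≢ lv x) → ∀ Γ → Fresh v (eL Γ)
eL-fresh v≢lv []            = []
eL-fresh v≢lv ((x , _) ∷ Γ) = v≢lv x ∷ eL-fresh v≢lv Γ

eRᗮ-fresh : ∀ {v} → (∀ α → v ≢ rv α) → ∀ Δ → Fresh v (eRᗮ Δ)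
eRᗮ-fresh v≢rv []            = []
eRᗮ-fresh v≢rv ((α , _) ∷ Δ) = v≢rv α ∷ eRᗮ-fresh v≢rv Δ

⟦_,_⟧ : LCtx → RCtx → SCtx
⟦ Γ , Δ ⟧ = eL Γ ++ eRᗮ Δ

yv-fresh : ∀ Γ Δ → Fresh yv ⟦ Γ , Δ ⟧
yv-fresh Γ Δ = ++⁺ (eL-fresh (λ _ ()) Γ) (eRᗮ-fresh (λ _ ()) Δ)

π₁-typing : ∀ {Γ y A₁ A₂} → Γ ∋ y ∶ ((A₁ ∨ A₂) ᵐᗮ) → y ≢ zv → Γ ⊢ π₁ y ∶ ty (A₁ ᵐᗮ)
π₁-typing p y≢z = abs (cut (ax (there y≢z p)) (inl (ax here)))

π₂-typing : ∀ {Γ y A₁ A₂} → Γ ∋ y ∶ ((A₁ ∨ A₂) ᵐᗮ) → y ≢ zv → Γ ⊢ π₂ y ∶ ty (A₂ ᵐᗮ)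
π₂-typing p y≢z = abs (cut (ax (there y≢z p)) (inr (ax here)))

-- The translation of λx u: if u^e : b under x : a, then
-- λy (λx (π₂(y) ⋆ u^e) ⋆ π₁(y)) : a^⊥ ∨ b, the variable y being fresh.
-- y is declared with type (a^⊥ ∨ b)^⊥, so that π₁(y) : a and π₂(y) : b^⊥.
lam-typing : ∀ {Γ x a b U} → Fresh yv Γ → ((lv x , a) ∷ Γ) ⊢ U ∶ ty b →
             Γ ⊢ lam yv (lam (lv x) (π₂ yv ⋆ U) ⋆ π₁ yv) ∶ ty ((a ᵐᗮ) ∨ b)
lam-typing {a = a} {b = b} fr dU =
  retype (ᵐᗮ-involutive ((a ᵐᗮ) ∨ b))
    (abs {A = ((a ᵐᗮ) ∨ b) ᵐᗮ}
      (cut {A = a}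
        (abs (cut {A = b} (π₂-typing (there (λ ()) here) (λ ()))
                          (rename (lift (weaken-fresh fr)) dU)))
        (retype (ᵐᗮ-involutive a) (π₁-typing here (λ ())))))

mutual
  term-typing : ∀ {Γ Δ t A} → Γ ▷ t ∶ A ∣ Δ → ⟦ Γ , Δ ⟧ ⊢ eTm t ∶ ty (eTy A)
  term-typing (ax p) = ax (∋-++ˡ (lookup-eL p))
  term-typing {Γ} {Δ} (lam d) = lam-typing (yv-fresh Γ Δ) (term-typing d)
  term-typing {Γ} (mu {A = A} p) =
    retype (ᵐᗮ-involutive (eTy A))
      (abs (rename (exchange (eL-fresh (λ _ ()) Γ)) (command-typing p)))
  term-typing (bar {A = A} e) = retype (sym (eTy-ᗮ A)) (coterm-typing e)

  coterm-typing : ∀ {Γ Δ e A} → Γ ∣ e ∶ A ▷ Δ → ⟦ Γ , Δ ⟧ ⊢ eCTm e ∶ ty (eTy A ᵐᗮ)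
  coterm-typing {Γ} (ax p) = ax (∋-++ʳ (eL-fresh (λ _ ()) Γ) (lookup-eRᗮ p))
  coterm-typing (app {A = A} d e) =
    retype (cong (_∧ _) (sym (ᵐᗮ-involutive (eTy A))))
      (pair (term-typing d) (coterm-typing e))
  coterm-typing (mut p) = abs (command-typing p)
  coterm-typing (tilde {A = A} d) =
    retype (sym (trans (cong _ᵐᗮ (eTy-ᗮ A)) (ᵐᗮ-involutive (eTy A))))
      (term-typing d)

  command-typing : ∀ {Γ Δ p} → p ∶⟨ Γ ▷ Δ ⟩ → ⟦ Γ , Δ ⟧ ⊢ eCmd p ∶ ⊥ₛ
  command-typing (cut d e) = cut (coterm-typing e) (term-typing d)

lemma4p2 : (∀ {Γ Δ t A} → Γ ▷ t ∶ A ∣ Δ → (eL Γ ++ eRᗮ Δ) ⊢ eTm t ∶ ty (eTy A))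
    × (∀ {Γ Δ e A} → Γ ∣ e ∶ A ▷ Δ → (eL Γ ++ eRᗮ Δ) ⊢ eCTm e ∶ ty (eTy A ᵐᗮ))
    × (∀ {Γ Δ p} → p ∶⟨ Γ ▷ Δ ⟩ → (eL Γ ++ eRᗮ Δ) ⊢ eCmd p ∶ ⊥ₛ)
lemma4p2 = term-typing , coterm-typing , command-typing
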